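{- For $n \in \mathbb{N}$ let $\sigma_n := \prod_{p \text{ prime}} p^{\lfloor n/(p-1) \rfloor}$. Then for every $n \in \mathbb{N}$, $$(n+1)! \mid \sigma_n \quad\text{and}\quad \sigma_n \mid n!\,\mathrm{lcm}(1, 2, \dots, n, n+1).$$
   Context: $\lfloor\cdot\rfloor$ is the floor function. -}

module Defs where

open import Data.Nat using (ℕ; zero; suc; _*_; _^_; _/_)
open import Data.Nat.LCM using (lcm)
open import Data.Nat.Primality using (prime?)
open import Relation.Nullary using (does)
open import Data.Bool using (if_then_else_)

-- Factor of σ_n contributed by the integer p = d + 1 (with d ≥ 1):
-- p ^ ⌊ n / (p - 1) ⌋ if p is prime, and 1 otherwise.
factor : ℕ → ℕ → ℕ
factor n zero    = 1
factor n (suc k) = if does (prime? (suc (suc k)))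
                     then suc (suc k) ^ (n / suc k)
                     else 1

-- σ n = ∏_{p prime} p ^ ⌊ n / (p - 1) ⌋.
-- Primes p with p - 1 > n contribute p ^ 0 = 1, so the product ranges
-- over p = d + 1 for d = 1, …, n, i.e. over primes p ≤ n + 1.
σ-upto : ℕ → ℕ → ℕ
σ-upto n zero    = 1
σ-upto n (suc d) = factor n (suc d) * σ-upto n d

σ : ℕ → ℕ
σ n = σ-upto n n

lcmUpTo : ℕ → ℕ
lcmUpTo zero    = 1
lcmUpTo (suc m) = lcm (suc m) (lcmUpTo m)

-- Let p be a prime and write ν_p for the p-adic valuation and s_p(m) for the
-- digit sum of m in base p.  Legendre's formula (p − 1) ν_p(m!) = m − s_p(m)
-- is proved by counting carries: incrementing the base-p expansion of m turns
-- its t trailing digits p − 1 into 0, so ν_p(m + 1) = t and the digit sum drops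
-- by (p − 1) t − 1.  The only p-part of σ_n is p ^ ⌊n/(p − 1)⌋.
--   • Since s_p(n + 1) ≥ 1, ν_p((n + 1)!) ≤ n/(p − 1), whence (n + 1)! ∣ σ_n.
--   • If p^e ≤ n + 1 < p^(e + 1), then n is not the string of e + 1 digits p − 1,
--     so s_p(n) < (p − 1)(e + 1) and ⌊n/(p − 1)⌋ ≤ ν_p(n!) + e, while p^e divides
--     lcm(1, …, n + 1); whence σ_n ∣ n! lcm(1, …, n + 1).
-- Divisibility is then read off prime power by prime power.

module Submission where

open import Defs

open import Data.List using (List; []; _∷_)
open import Data.List.Relation.Unary.All using (All; []; _∷_)
open import Data.Nat
open import Data.Nat.Divisibility
open import Data.Nat.DivMod using (_/_; m*n/n≡m; /-monoˡ-≤; m<n*o⇒m/o<n; m<n⇒m/n≡0)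
open import Data.Nat.LCM using (m∣lcm[m,n]; n∣lcm[m,n])
open import Data.Nat.ListAction using (sum; product)
open import Data.Nat.Primality
open import Data.Nat.Primality.Factorisation using (factorise; PrimeFactorisation)
open import Data.Nat.Properties
open import Data.Nat.Tactic.RingSolver using (solve-∀)
open import Data.Product using (∃-syntax; _×_; _,_)
open import Data.Sum using (inj₁; inj₂; [_,_]′)
open import Relation.Nullary using (¬_; yes; no)
open import Relation.Nullary.Decidable using (dec-true; dec-false)
open import Relation.Nullary.Negation using (contradiction)
open import Relation.Binary.PropositionalEquality
open import Function using (_∘_)

^-monoʳ-∣ : ∀ p {i j} → i ≤ j → p ^ i ∣ p ^ j
^-monoʳ-∣ p {i} {j} i≤j = divides (p ^ (j ∸ i)) (begin
  p ^ j               ≡⟨ cong (p ^_) (m+[n∸m]≡n i≤j) ⟨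
  p ^ (i + (j ∸ i))   ≡⟨ ^-distribˡ-+-* p i (j ∸ i) ⟩
  p ^ i * p ^ (j ∸ i) ≡⟨ *-comm (p ^ i) _ ⟩
  p ^ (j ∸ i) * p ^ i ∎)
  where open ≡-Reasoning

*≤⇒≤/ : ∀ {m n} d .{{_ : NonZero d}} → m * d ≤ n → m ≤ n / d
*≤⇒≤/ {m} {n} d m*d≤n = subst (_≤ n / d) (m*n/n≡m m d) (/-monoˡ-≤ d m*d≤n)

p^e≤n<p^[1+e] : ∀ {p} → 1 < p → ∀ n → .{{NonZero n}} → ∃[ e ] p ^ e ≤ n × n < p ^ suc e
p^e≤n<p^[1+e] {p} 1<p 1 = 0 , ≤-refl , subst (1 <_) (sym (*-identityʳ p)) 1<p
p^e≤n<p^[1+e] {p} 1<p (suc (suc n)) with p^e≤n<p^[1+e] 1<p (suc n)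
... | e , p^e≤1+n , 1+n<p^[1+e] with suc (suc n) <? p ^ suc e
...   | yes 2+n<p^[1+e] = e , m≤n⇒m≤1+n p^e≤1+n , 2+n<p^[1+e]
...   | no  2+n≮p^[1+e] = suc e , p^[1+e]≤2+n , subst (_< p ^ suc (suc e)) p^[1+e]≡2+n p^[1+e]<p^[2+e]
  where
  p^[1+e]≤2+n = ≮⇒≥ 2+n≮p^[1+e]
  p^[1+e]≡2+n = ≤-antisym p^[1+e]≤2+n 1+n<p^[1+e]
  p^[1+e]<p^[2+e] = ^-monoʳ-< p 1<p (n<1+n (suc e))

prime⇒∤1 : ∀ {p} → Prime p → ¬ p ∣ 1
prime⇒∤1 pp p∣1 = ¬prime[1] (subst Prime (∣1⇒≡1 p∣1) pp)

prime∣prime⇒≡ : ∀ {p q} → Prime p → Prime q → p ∣ q → p ≡ q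
prime∣prime⇒≡ pp pq p∣q with prime⇒irreducible pq p∣q
... | inj₁ refl = contradiction pp ¬prime[1]
... | inj₂ p≡q  = p≡q

prime∣prime^⇒≡ : ∀ {p q} e → Prime p → Prime q → p ∣ q ^ e → p ≡ q
prime∣prime^⇒≡ zero    pp pq p∣1 = contradiction p∣1 (prime⇒∤1 pp)
prime∣prime^⇒≡ (suc e) pp pq p∣q^[1+e] with euclidsLemma _ _ pp p∣q^[1+e]
... | inj₁ p∣q   = prime∣prime⇒≡ pp pq p∣q
... | inj₂ p∣q^e = prime∣prime^⇒≡ e pp pq p∣q^e

prime^∣∧∤⇒≡0 : ∀ {p a} k → Prime p → ¬ p ∣ a → p ^ k ∣ a → k ≡ 0
prime^∣∧∤⇒≡0         zero    pp p∤a _      = refl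
prime^∣∧∤⇒≡0 {p} (suc k) pp p∤a p^k+1∣a = contradiction (∣-trans (m∣m*n (p ^ k)) p^k+1∣a) p∤a

prime^∣prime^⇒≤ : ∀ {p} i j → Prime p → p ^ i ∣ p ^ j → i ≤ j
prime^∣prime^⇒≤ {p} i j pp p^i∣p^j with i ≤? j
... | yes i≤j = i≤j
... | no  i≰j = contradiction (∣⇒≤ {{m^n≢0 p j}} p^i∣p^j) (<⇒≱ (^-monoʳ-< p 1<p (≰⇒> i≰j)))
  where
  instance _ = prime⇒nonZero pp
  1<p : 1 < p
  1<p = nonTrivial⇒n>1 p {{prime⇒nonTrivial pp}}

PowerSplit : ℕ → ℕ → ℕ → ℕ → Set
PowerSplit p k a b = ∃[ i ] ∃[ j ] i + j ≡ k × p ^ i ∣ a × p ^ j ∣ b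

PowerSplit-comm : ∀ {p k a b} → PowerSplit p k a b → PowerSplit p k b a
PowerSplit-comm (i , j , i+j≡k , p^i∣a , p^j∣b) = j , i , trans (+-comm j i) i+j≡k , p^j∣b , p^i∣a

prime^∣*⇒split : ∀ {p} k {a b} → Prime p → p ^ k ∣ a * b → PowerSplit p k a b
prime^∣*⇒split zero {a} {b} pp _ = 0 , 0 , refl , 1∣ a , 1∣ b
prime^∣*⇒split {p} (suc k) {a} {b} pp p^k+1∣ab =
  [ (λ p∣a → splitOff p∣a p^k+1∣ab)
  , (λ p∣b → PowerSplit-comm (splitOff p∣b (subst (p ^ suc k ∣_) (*-comm a b) p^k+1∣ab)))
  ]′ (euclidsLemma a b pp (∣-trans (m∣m*n (p ^ k)) p^k+1∣ab))
  where
  instance _ = prime⇒nonZero pp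
  splitOff : ∀ {a b} → p ∣ a → p ^ suc k ∣ a * b → PowerSplit p (suc k) a b
  splitOff {a} {b} p∣a p^k+1∣ab =
    let i , j , i+j≡k , p^i∣a′ , p^j∣b = prime^∣*⇒split k pp p^k∣a′b
    in suc i , j , cong suc i+j≡k , subst (p ^ suc i ∣_) (sym a≡p*a′) (*-monoʳ-∣ p p^i∣a′) , p^j∣b
    where
    a≡p*a′ : a ≡ p * quotient p∣a
    a≡p*a′ = m∣n⇒n≡m*quotient p∣a
    p^k∣a′b : p ^ k ∣ quotient p∣a * b
    p^k∣a′b = *-cancelˡ-∣ p
      (subst (p ^ suc k ∣_) (trans (cong (_* b) a≡p*a′) (*-assoc p _ b)) p^k+1∣ab)

prime^∣*∧∤ˡ⇒∣ʳ : ∀ {p} k {a b} → Prime p → ¬ p ∣ a → p ^ k ∣ a * b → p ^ k ∣ b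
prime^∣*∧∤ˡ⇒∣ʳ {p} k {b = b} pp p∤a p^k∣ab =
  let i , j , i+j≡k , p^i∣a , p^j∣b = prime^∣*⇒split k pp p^k∣ab
      j≡k = trans (cong (_+ j) (sym (prime^∣∧∤⇒≡0 i pp p∤a p^i∣a))) i+j≡k
  in subst (λ e → p ^ e ∣ b) j≡k p^j∣b

prime^∣*∧∤ʳ⇒∣ˡ : ∀ {p} k {a b} → Prime p → ¬ p ∣ b → p ^ k ∣ a * b → p ^ k ∣ a
prime^∣*∧∤ʳ⇒∣ˡ {p} k {a} {b} pp p∤b p^k∣ab =
  prime^∣*∧∤ˡ⇒∣ʳ k pp p∤b (subst (p ^ k ∣_) (*-comm a b) p^k∣ab)

PrimePowersDivide : ℕ → ℕ → Set
PrimePowersDivide a b = ∀ {p} k → Prime p → p ^ k ∣ a → p ^ k ∣ b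

product∣-byPrimePowers : ∀ {ps} → All Prime ps →
                         ∀ {b} → PrimePowersDivide (product ps) b → product ps ∣ b
product∣-byPrimePowers []                 {b} _ = 1∣ b
product∣-byPrimePowers {p ∷ ps} (pp ∷ pps) {b} H =
  subst (p * product ps ∣_) (sym b≡p*r) (*-monoʳ-∣ p (product∣-byPrimePowers pps H′))
  where
  instance _ = prime⇒nonZero pp
  p∣b : p ∣ b
  p∣b = subst (_∣ b) (*-identityʳ p) (H 1 pp (*-monoʳ-∣ p (1∣ product ps)))
  r = quotient p∣b
  b≡p*r : b ≡ p * r
  b≡p*r = m∣n⇒n≡m*quotient p∣b
  H′ : PrimePowersDivide (product ps) r
  H′ {q} k pq q^k∣ with q ≟ p
  ... | yes refl = *-cancelˡ-∣ p (subst (_ ∣_) b≡p*r (H (suc k) pq (*-monoʳ-∣ p q^k∣)))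
  ... | no  q≢p  = prime^∣*∧∤ˡ⇒∣ʳ k pq (q≢p ∘ prime∣prime⇒≡ pq pp)
                     (subst (_ ∣_) b≡p*r (H k pq (∣n⇒∣m*n p q^k∣)))

∣-byPrimePowers : ∀ {a b} .{{_ : NonZero a}} → PrimePowersDivide a b → a ∣ b
∣-byPrimePowers {a} {b} H =
  subst (_∣ b) (sym a≡∏)
    (product∣-byPrimePowers factorsPrime (λ k pp → H k pp ∘ subst (_ ∣_) (sym a≡∏)))
  where open PrimeFactorisation (factorise a) renaming (isFactorisation to a≡∏)

module BaseExpansion (k : ℕ) where

  -- Base p = k + 2 with largest digit d = p − 1; an expansion is the list of its
  -- digits, least significant first.

  d p : ℕ
  d = suc k
  p = suc d

  increment : List ℕ → List ℕ
  increment []       = 1 ∷ []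
  increment (x ∷ xs) with x ≟ d
  ... | yes _ = 0 ∷ increment xs
  ... | no  _ = suc x ∷ xs

  trailingMaxDigits : List ℕ → ℕ
  trailingMaxDigits []       = 0
  trailingMaxDigits (x ∷ xs) with x ≟ d
  ... | yes _ = suc (trailingMaxDigits xs)
  ... | no  _ = 0

  value : List ℕ → ℕ
  value []       = 0
  value (x ∷ xs) = x + p * value xs

  ValidDigits : List ℕ → Set
  ValidDigits = All (_≤ d)

  digits : ℕ → List ℕ
  digits zero    = []
  digits (suc m) = increment (digits m)

  digitSum : ℕ → ℕ
  digitSum m = sum (digits m)

  -- ν_p(m + 1) is the number of trailing digits d of m, so this is ν_p(m!).
  legendre : ℕ → ℕ
  legendre zero    = 0
  legendre (suc m) = legendre m + trailingMaxDigits (digits m)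

  suc-value-d∷ : ∀ xs → suc (value (d ∷ xs)) ≡ p * suc (value xs)
  suc-value-d∷ xs = lemma d (value xs)
    where
    lemma : ∀ d v → suc (d + suc d * v) ≡ suc d * suc v
    lemma = solve-∀

  value-increment : ∀ xs → value (increment xs) ≡ suc (value xs)
  value-increment []       = cong suc (*-zeroʳ p)
  value-increment (x ∷ xs) with x ≟ d
  ... | yes refl = trans (cong (p *_) (value-increment xs)) (sym (suc-value-d∷ xs))
  ... | no  _    = refl

  value-digits : ∀ m → value (digits m) ≡ m
  value-digits zero    = refl
  value-digits (suc m) = trans (value-increment (digits m)) (cong suc (value-digits m))

  increment-valid : ∀ {xs} → ValidDigits xs → ValidDigits (increment xs)
  increment-valid []                = s≤s z≤n ∷ []
  increment-valid {x ∷ xs} (x≤d ∷ xs-valid) with x ≟ d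
  ... | yes _   = z≤n ∷ increment-valid xs-valid
  ... | no  x≢d = ≤∧≢⇒< x≤d x≢d ∷ xs-valid

  digits-valid : ∀ m → ValidDigits (digits m)
  digits-valid zero    = []
  digits-valid (suc m) = increment-valid (digits-valid m)

  sum-increment : ∀ xs → sum (increment xs) + d * trailingMaxDigits xs ≡ suc (sum xs)
  sum-increment []       = cong suc (*-zeroʳ d)
  sum-increment (x ∷ xs) with x ≟ d
  ... | yes refl = begin
    s′ + d * suc t   ≡⟨ lemma s′ d t ⟩
    d + (s′ + d * t) ≡⟨ cong (d +_) (sum-increment xs) ⟩
    d + suc (sum xs) ≡⟨ +-suc d (sum xs) ⟩
    suc (d + sum xs) ∎
    where
    open ≡-Reasoning
    s′ = sum (increment xs)
    t  = trailingMaxDigits xs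
    lemma : ∀ s d t → s + d * suc t ≡ d + (s + d * t)
    lemma = solve-∀
  ... | no  _    = cong suc (trans (cong (x + sum xs +_) (*-zeroʳ d)) (+-identityʳ _))

  legendre-digitSum : ∀ m → d * legendre m + digitSum m ≡ m
  legendre-digitSum zero    = cong (_+ 0) (*-zeroʳ d)
  legendre-digitSum (suc m) = begin
    d * (l + t) + s′                 ≡⟨ lemma l t s′ d ⟩
    d * l + (s′ + d * t)             ≡⟨ cong (d * l +_) (sum-increment (digits m)) ⟩
    d * l + suc (digitSum m)         ≡⟨ +-suc (d * l) (digitSum m) ⟩
    suc (d * l + digitSum m)         ≡⟨ cong suc (legendre-digitSum m) ⟩
    suc m                            ∎
    where
    open ≡-Reasoning
    l  = legendre m
    t  = trailingMaxDigits (digits m)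
    s′ = sum (increment (digits m))
    lemma : ∀ l t s d → d * (l + t) + s ≡ d * l + (s + d * t)
    lemma = solve-∀

  p^trailingMaxDigits∣suc-value : ∀ xs → p ^ trailingMaxDigits xs ∣ suc (value xs)
  p^trailingMaxDigits∣suc-value []       = 1∣ 1
  p^trailingMaxDigits∣suc-value (x ∷ xs) with x ≟ d
  ... | yes refl = subst (p * p ^ trailingMaxDigits xs ∣_) (sym (suc-value-d∷ xs))
                     (*-monoʳ-∣ p (p^trailingMaxDigits∣suc-value xs))
  ... | no  _    = 1∣ _

  p^∣suc-value⇒≤trailingMaxDigits : ∀ i {xs} → ValidDigits xs →
                                    p ^ i ∣ suc (value xs) → i ≤ trailingMaxDigits xs
  p^∣suc-value⇒≤trailingMaxDigits zero    _ _ = z≤n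
  p^∣suc-value⇒≤trailingMaxDigits (suc i) {[]} _ p^i+1∣1 =
    contradiction (∣1⇒≡1 (∣-trans (m∣m*n {p} (p ^ i)) p^i+1∣1)) λ ()
  p^∣suc-value⇒≤trailingMaxDigits (suc i) {x ∷ xs} (x≤d ∷ xs-valid) p^i+1∣ with x ≟ d
  ... | yes refl = s≤s (p^∣suc-value⇒≤trailingMaxDigits i xs-valid
                         (*-cancelˡ-∣ p (subst (p ^ suc i ∣_) (suc-value-d∷ xs) p^i+1∣)))
  ... | no  x≢d  = contradiction (∣⇒≤ p∣1+x) (<⇒≱ (s≤s (≤∧≢⇒< x≤d x≢d)))
    where
    p∣1+x : p ∣ suc x
    p∣1+x = ∣m+n∣m⇒∣n (subst (p ∣_) (+-comm (suc x) _) (∣-trans (m∣m*n (p ^ i)) p^i+1∣))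
                      (m∣m*n {p} (value xs))

  p^legendre∣! : ∀ m → p ^ legendre m ∣ m !
  p^legendre∣! zero    = 1∣ 1
  p^legendre∣! (suc m) = subst (_∣ suc m !) p^t*p^l≡p^[l+t] (*-pres-∣ p^t∣1+m (p^legendre∣! m))
    where
    t = trailingMaxDigits (digits m)
    p^t∣1+m : p ^ t ∣ suc m
    p^t∣1+m = subst (λ v → p ^ t ∣ suc v) (value-digits m) (p^trailingMaxDigits∣suc-value (digits m))
    p^t*p^l≡p^[l+t] : p ^ t * p ^ legendre m ≡ p ^ (legendre m + t)
    p^t*p^l≡p^[l+t] = trans (*-comm (p ^ t) _) (sym (^-distribˡ-+-* p (legendre m) t))

  p^∣!⇒≤legendre : Prime p → ∀ m i → p ^ i ∣ m ! → i ≤ legendre m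
  p^∣!⇒≤legendre pp zero    i p^i∣1  = ≤-reflexive (prime^∣∧∤⇒≡0 i pp (prime⇒∤1 pp) p^i∣1)
  p^∣!⇒≤legendre pp (suc m) i p^i∣[1+m]! with prime^∣*⇒split i {suc m} {m !} pp p^i∣[1+m]!
  ... | j , l , refl , p^j∣1+m , p^l∣m! = subst (j + l ≤_) (+-comm t (legendre m))
        (+-mono-≤ (p^∣suc-value⇒≤trailingMaxDigits j (digits-valid m) p^j∣1+value)
                  (p^∣!⇒≤legendre pp m l p^l∣m!))
    where
    t = trailingMaxDigits (digits m)
    p^j∣1+value : p ^ j ∣ suc (value (digits m))
    p^j∣1+value = subst (λ v → p ^ j ∣ suc v) (sym (value-digits m)) p^j∣1+m

  value≡0⇒sum≡0 : ∀ xs → value xs ≡ 0 → sum xs ≡ 0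
  value≡0⇒sum≡0 []       _      = refl
  value≡0⇒sum≡0 (x ∷ xs) value≡0
    with m+n≡0⇒m≡0 x value≡0 | m*n≡0⇒m≡0∨n≡0 p {value xs} (m+n≡0⇒n≡0 x value≡0)
  ... | refl | inj₂ value-xs≡0 = value≡0⇒sum≡0 xs value-xs≡0

  value<p^⇒sum≤ : ∀ {xs} E → ValidDigits xs → value xs < p ^ E → sum xs ≤ d * E
  value<p^⇒sum≤ {[]}     _       _ _ = z≤n
  value<p^⇒sum≤ {x ∷ xs} zero    _ (s≤s value≤0) =
    ≤-reflexive (trans (value≡0⇒sum≡0 (x ∷ xs) (n≤0⇒n≡0 value≤0)) (sym (*-zeroʳ d)))
  value<p^⇒sum≤ {x ∷ xs} (suc E) (x≤d ∷ xs-valid) value<p^E+1 =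
    subst (x + sum xs ≤_) (sym (*-suc d E)) (+-mono-≤ x≤d (value<p^⇒sum≤ E xs-valid value-xs<p^E))
    where
    value-xs<p^E : value xs < p ^ E
    value-xs<p^E = *-cancelˡ-< p (value xs) (p ^ E) (≤-<-trans (m≤n+m (p * value xs) x) value<p^E+1)

  value+1<p^⇒sum< : ∀ {xs} E → ValidDigits xs → suc (value xs) < p ^ E → sum xs < d * E
  value+1<p^⇒sum< {[]}     zero    _ (s≤s ())
  value+1<p^⇒sum< {[]}     (suc E) _ _ = ≤-trans (s≤s z≤n) (m≤m*n d (suc E))
  value+1<p^⇒sum< {x ∷ xs} zero    _ (s≤s ())
  value+1<p^⇒sum< {x ∷ xs} (suc E) (x≤d ∷ xs-valid) value+1<p^E+1 with x ≟ d
  ... | yes refl = subst (suc (d + sum xs) ≤_) (sym (*-suc d E))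
                     (subst (_≤ d + d * E) (+-suc d (sum xs))
                       (+-monoʳ-≤ d (value+1<p^⇒sum< E xs-valid value-xs+1<p^E)))
    where
    value-xs+1<p^E : suc (value xs) < p ^ E
    value-xs+1<p^E = *-cancelˡ-< p (suc (value xs)) (p ^ E)
                       (subst (_< p * p ^ E) (suc-value-d∷ xs) value+1<p^E+1)
  ... | no  x≢d  = subst (suc (x + sum xs) ≤_) (sym (*-suc d E))
                     (+-mono-≤ (≤∧≢⇒< x≤d x≢d) (value<p^⇒sum≤ E xs-valid value-xs<p^E))
    where
    value-xs<p^E : value xs < p ^ E
    value-xs<p^E = *-cancelˡ-< p (value xs) (p ^ E)
                     (≤-<-trans (m≤n+m (p * value xs) x) (<-trans (n<1+n _) value+1<p^E+1))

  0<sum-increment : ∀ xs → 0 < sum (increment xs)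
  0<sum-increment []       = s≤s z≤n
  0<sum-increment (x ∷ xs) with x ≟ d
  ... | yes _ = 0<sum-increment xs
  ... | no  _ = s≤s z≤n

  p^∣[1+n]!⇒≤n/d : Prime p → ∀ n K → p ^ K ∣ suc n ! → K ≤ n / d
  p^∣[1+n]!⇒≤n/d pp n K p^K∣[1+n]! = *≤⇒≤/ d (s≤s⁻¹ (begin-strict
    K * d                        ≡⟨ *-comm K d ⟩
    d * K                        ≤⟨ *-monoʳ-≤ d (p^∣!⇒≤legendre pp (suc n) K p^K∣[1+n]!) ⟩
    d * L                        <⟨ m<m+n (d * L) (0<sum-increment (digits n)) ⟩
    d * L + digitSum (suc n)     ≡⟨ legendre-digitSum (suc n) ⟩
    suc n                        ∎))
    where
    open ≤-Reasoning
    L = legendre (suc n)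

  n/d≤legendre+e : ∀ n e → suc n < p ^ suc e → n / d ≤ legendre n + e
  n/d≤legendre+e n e 1+n<p^[1+e] = s≤s⁻¹ (m<n*o⇒m/o<n (begin-strict
    n                            ≡⟨ legendre-digitSum n ⟨
    d * L + digitSum n           <⟨ +-monoʳ-< (d * L) digitSum<d*[1+e] ⟩
    d * L + d * suc e            ≡⟨ *-distribˡ-+ d L (suc e) ⟨
    d * (L + suc e)              ≡⟨ cong (d *_) (+-suc L e) ⟩
    d * suc (L + e)              ≡⟨ *-comm d _ ⟩
    suc (L + e) * d              ∎))
    where
    open ≤-Reasoning
    L = legendre n
    digitSum<d*[1+e] : digitSum n < d * suc e
    digitSum<d*[1+e] = value+1<p^⇒sum< (suc e) (digits-valid n)
                         (subst (λ v → suc v < p ^ suc e) (sym (value-digits n)) 1+n<p^[1+e])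

factor-prime : ∀ n {k} → Prime (suc (suc k)) → factor n (suc k) ≡ suc (suc k) ^ (n / suc k)
factor-prime n {k} pp rewrite dec-true (prime? (suc (suc k))) pp = refl

factor-¬prime : ∀ n {k} → ¬ Prime (suc (suc k)) → factor n (suc k) ≡ 1
factor-¬prime n {k} ¬pp rewrite dec-false (prime? (suc (suc k))) ¬pp = refl

factor≢0 : ∀ n m → NonZero (factor n m)
factor≢0 n zero    = _
factor≢0 n (suc k) with prime? (suc (suc k))
... | yes pp  = subst NonZero (sym (factor-prime n pp)) (m^n≢0 (suc (suc k)) (n / suc k))
... | no  ¬pp = subst NonZero (sym (factor-¬prime n ¬pp)) _

σ-upto≢0 : ∀ n N → NonZero (σ-upto n N)
σ-upto≢0 n zero    = _
σ-upto≢0 n (suc N) = m*n≢0 _ _ {{factor≢0 n (suc N)}} {{σ-upto≢0 n N}}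

prime∤factor : ∀ n {k m} → Prime (suc (suc k)) → m ≢ suc k → ¬ suc (suc k) ∣ factor n m
prime∤factor n     {m = zero}  pp _ = prime⇒∤1 pp
prime∤factor n {k} {m = suc j} pp 1+j≢1+k with prime? (suc (suc j))
... | yes pq  = λ p∣factor → 1+j≢1+k (sym (suc-injective
                  (prime∣prime^⇒≡ (n / suc j) pp pq (subst (_ ∣_) (factor-prime n pq) p∣factor))))
... | no  ¬pq = subst (λ f → ¬ suc (suc k) ∣ f) (sym (factor-¬prime n ¬pq)) (prime⇒∤1 pp)

prime∤σ-upto : ∀ n {k} N → Prime (suc (suc k)) → N < suc k → ¬ suc (suc k) ∣ σ-upto n N
prime∤σ-upto n zero    pp _     = prime⇒∤1 pp
prime∤σ-upto n (suc N) pp 1+N<1+k p∣σ with euclidsLemma (factor n (suc N)) (σ-upto n N) pp p∣σ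
... | inj₁ p∣factor = prime∤factor n pp (<⇒≢ 1+N<1+k) p∣factor
... | inj₂ p∣σ-upto = prime∤σ-upto n N pp (<-trans (n<1+n N) 1+N<1+k) p∣σ-upto

p^[n/d]∣σ-upto : ∀ n {k} N → Prime (suc (suc k)) → suc k ≤ N →
                 suc (suc k) ^ (n / suc k) ∣ σ-upto n N
p^[n/d]∣σ-upto n {k} (suc N) pp 1+k≤1+N with suc k ≟ suc N
... | yes refl  = ∣m⇒∣m*n (σ-upto n N) (∣-reflexive (sym (factor-prime n pp)))
... | no  1+k≢1+N =
  ∣n⇒∣m*n (factor n (suc N)) (p^[n/d]∣σ-upto n N pp (s≤s⁻¹ (≤∧≢⇒< 1+k≤1+N 1+k≢1+N)))

p^[n/d]∣σ : ∀ n {k} → Prime (suc (suc k)) → suc (suc k) ^ (n / suc k) ∣ σ n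
p^[n/d]∣σ n {k} pp with suc k ≤? n
... | yes 1+k≤n = p^[n/d]∣σ-upto n n pp 1+k≤n
... | no  1+k≰n = subst (λ e → suc (suc k) ^ e ∣ σ n) (sym (m<n⇒m/n≡0 (≰⇒> 1+k≰n))) (1∣ σ n)

p^∣σ-upto⇒≤n/d : ∀ n {k} N K → Prime (suc (suc k)) →
                 suc (suc k) ^ K ∣ σ-upto n N → K ≤ n / suc k
p^∣σ-upto⇒≤n/d n {k} zero K pp p^K∣1 =
  subst (_≤ n / suc k) (sym (prime^∣∧∤⇒≡0 K pp (prime⇒∤1 pp) p^K∣1)) z≤n
p^∣σ-upto⇒≤n/d n {k} (suc N) K pp p^K∣σ with suc N ≟ suc k
... | yes refl  = prime^∣prime^⇒≤ K (n / suc k) pp (subst (_ ∣_) (factor-prime n pp)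
                    (prime^∣*∧∤ʳ⇒∣ˡ K pp (prime∤σ-upto n N pp ≤-refl) p^K∣σ))
... | no  1+N≢1+k =
  p^∣σ-upto⇒≤n/d n N K pp (prime^∣*∧∤ˡ⇒∣ʳ K pp (prime∤factor n pp 1+N≢1+k) p^K∣σ)

∣lcmUpTo : ∀ {m} N → 0 < m → m ≤ N → m ∣ lcmUpTo N
∣lcmUpTo     zero    (s≤s _) ()
∣lcmUpTo {m} (suc N) 0<m m≤1+N with m ≟ suc N
... | yes refl  = m∣lcm[m,n] m (lcmUpTo N)
... | no  m≢1+N =
  ∣-trans (∣lcmUpTo N 0<m (s≤s⁻¹ (≤∧≢⇒< m≤1+N m≢1+N))) (n∣lcm[m,n] (suc N) (lcmUpTo N))

[1+n]!∣σ : ∀ n → suc n ! ∣ σ n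
[1+n]!∣σ n = ∣-byPrimePowers {{suc n !≢0}} p^K∣[1+n]!⇒p^K∣σ
  where
  p^K∣[1+n]!⇒p^K∣σ : PrimePowersDivide (suc n !) (σ n)
  p^K∣[1+n]!⇒p^K∣σ {0}           _ pp _ = contradiction pp ¬prime[0]
  p^K∣[1+n]!⇒p^K∣σ {1}           _ pp _ = contradiction pp ¬prime[1]
  p^K∣[1+n]!⇒p^K∣σ {suc (suc k)} K pp p^K∣[1+n]! =
    ∣-trans (^-monoʳ-∣ _ (p^∣[1+n]!⇒≤n/d pp n K p^K∣[1+n]!)) (p^[n/d]∣σ n pp)
    where open BaseExpansion k

σ∣n!*lcmUpTo[1+n] : ∀ n → σ n ∣ n ! * lcmUpTo (suc n)
σ∣n!*lcmUpTo[1+n] n = ∣-byPrimePowers {{σ-upto≢0 n n}} p^K∣σ⇒p^K∣n!*lcm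
  where
  p^K∣σ⇒p^K∣n!*lcm : PrimePowersDivide (σ n) (n ! * lcmUpTo (suc n))
  p^K∣σ⇒p^K∣n!*lcm {0}           _ pp _ = contradiction pp ¬prime[0]
  p^K∣σ⇒p^K∣n!*lcm {1}           _ pp _ = contradiction pp ¬prime[1]
  p^K∣σ⇒p^K∣n!*lcm {suc (suc k)} K pp p^K∣σ with p^e≤n<p^[1+e] (s≤s (s≤s z≤n)) (suc n)
  ... | e , p^e≤1+n , 1+n<p^[1+e] = ∣-trans (^-monoʳ-∣ p K≤legendre+e)
          (subst (_∣ n ! * lcmUpTo (suc n)) (sym (^-distribˡ-+-* p (legendre n) e))
            (*-pres-∣ (p^legendre∣! n) (∣lcmUpTo (suc n) (m^n>0 p e) p^e≤1+n)))
    where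
    open BaseExpansion k
    K≤legendre+e : K ≤ legendre n + e
    K≤legendre+e = ≤-trans (p^∣σ-upto⇒≤n/d n n K pp p^K∣σ) (n/d≤legendre+e n e 1+n<p^[1+e])

proposition3 : (n : ℕ) → ((suc n) ! ∣ σ n) × (σ n ∣ (n !) * lcmUpTo (suc n))
proposition3 n = [1+n]!∣σ n , σ∣n!*lcmUpTo[1+n] n
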